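{- In the setting described in the context, let $N$ be even and suppose $B^2\equiv D+12N\pmod{16N}$. Then $4\mid\theta$ if one of the following conditions is met: (a) $D\equiv1\pmod8$; (b) $8\,\|\,D$ and $2\,\|\,N$; (c) $4\,\|\,D$ and $4\mid N$. Moreover, in case (b) $4\mid B$, and in case (c) $2\,\|\,B$.
   Context: Setting: Let $N>1$ be an integer, $N=2^{\lambda(N)}N_1$ with $N_1$ odd. Let $D=c^2\Delta<0$ be a discriminant with fundamental part $\Delta$ and conductor $c$, $K=\mathbb Q(\sqrt D)$, $\mathcal O$ the order of discriminant $D$. Let $[A,B,C]$ be a primitive positive definite integral quadratic form with $B^2-4AC=D$, $\gcd(A,N)=1$ and $N\mid C$. Let $\alpha=\frac{ -B+\sqrt D}{2A}$, so $\mathcal O=\mathbb Z+\mathbb Z A\alpha$. Let $u,v\in\mathbb Z$ be such that $\pi=u+vA\alpha$ has norm $p=u^2-uvB+v^2AC$ a prime number not dividing $6cN$ that splits in $\mathcal O$, and assume $p\mid C$ and $p\mid u$. Set $u'=u-vB$. Let $v_1$, $A_1$ be the odd parts of $v$, $A$ ($v_1=1$ if $v=0$). Define the integer $\theta=(N-1)v\left(u'\frac{C}{Np}+A\left(\frac up(1-u'^2)-u'\right)\right)+3v_1A_1(N_1-1)(u'-1)+\frac{3\lambda(N)(u'^2-1)}{2}.$ The notation $2^k\,\|\,n$ means $2^k\mid n$ and $2^{k+1}\nmid n$. -}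

module Defs where

open import Data.Nat using (ℕ)
open import Data.Integer using (ℤ; +_; _+_; _-_; _*_; _^_; -_; 0ℤ; 1ℤ)
open import Data.Integer.Divisibility using (_∣_)
open import Data.Product using (Σ; _×_)
open import Data.Sum using (_⊎_)
open import Relation.Binary.PropositionalEquality using (_≡_)
open import Relation.Nullary using (¬_)

Cong : ℤ → ℤ → ℤ → Set
Cong a b m = m ∣ (a - b)

Odd : ℤ → Set
Odd n = ¬ (+ 2 ∣ n)

_∥₂_ : ℕ → ℤ → Set
k ∥₂ n = ((+ 2) ^ k ∣ n) × ¬ ((+ 2) ^ (ℕ.suc k) ∣ n)

-- m is the odd part of n (sign-preserving: n = 2^k m, m odd); by convention 1 if n = 0
IsOddPart : ℤ → ℤ → Set
IsOddPart n m = (n ≡ 0ℤ × m ≡ 1ℤ) ⊎ Σ ℕ (λ k → Odd m × n ≡ (+ 2) ^ k * m)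

Squarefree : ℤ → Set
Squarefree n = (q : ℕ) → (+ q) * (+ q) ∣ n → q ≡ 1

Fundamental : ℤ → Set
Fundamental Δ =
  (Cong Δ 1ℤ (+ 4) × Squarefree Δ)
  ⊎ Σ ℤ (λ m → Δ ≡ + 4 * m × (Cong m (+ 2) (+ 4) ⊎ Cong m (+ 3) (+ 4)) × Squarefree m)

Primitive3 : ℤ → ℤ → ℤ → Set
Primitive3 a b c = (d : ℕ) → + d ∣ a → + d ∣ b → + d ∣ c → d ≡ 1

Coprime : ℤ → ℤ → Set
Coprime a b = (d : ℕ) → + d ∣ a → + d ∣ b → d ≡ 1

-- an odd prime p not dividing the conductor splits in the order of discriminant D
-- iff the Kronecker/Legendre symbol (D/p) = 1, i.e. p ∤ D and D is a square mod p
SplitsInOrder : ℤ → ℕ → Set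
SplitsInOrder D p = ¬ (+ p ∣ D) × Σ ℤ (λ x → Cong (x * x) D (+ p))

-- twiceTheta = 2θ (θ is stated in the paper to be an integer; 4 ∣ θ ⇔ 8 ∣ 2θ).
-- Arguments: Cq = C/(Np), uq = u/p, lam = λ(N), N₁ = odd part of N,
-- v₁, A₁ = odd parts of v, A; u' = u - vB.
twiceTheta : (N : ℕ) (lam : ℕ) (N₁ : ℤ) (A B Cq u uq v v₁ A₁ : ℤ) → ℤ
twiceTheta N lam N₁ A B Cq u uq v v₁ A₁ =
  + 2 * ((+ N - 1ℤ) * v * (u' * Cq + A * (uq * (1ℤ - u' * u') - u'))
         + + 3 * v₁ * A₁ * (N₁ - 1ℤ) * (u' - 1ℤ))
  + + 3 * + lam * (u' * u' - 1ℤ)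
  where
  u' = u - v * B

{-# OPTIONS --safe #-}
module Submission where

-- Write u' = u − vB.  With C = N·p·Cq and u = p·uq, the norm equation divided by p reads
-- uq·u' + v²A·N·Cq = 1, so u' is odd (N is even), and B² ≡ D + 12N (mod 16N) with
-- D = B² − 4AC says A·p·Cq ≡ 3 (mod 4).  Modulo 8, 2θ ≡ 2(N − 1)u'·v(Cq − A), every other term
-- carrying a factor u'² − 1 or (N₁ − 1)(u' − 1).  If v is even, 4 ∣ v(Cq − A) since A and Cq
-- are odd.  If v is odd, look at 4p = (2u − vB)² − v²D: in case (a) the right side is ≡ 0
-- (mod 8), impossible for odd p; in case (b) 8 ∣ B² forces 4 ∣ B, and in case (c) B² = 4·odd
-- forces B = 2b with b odd and D ≡ 4 (mod 16).  Either way p ≡ 3 (mod 4), hence Cq ≡ A (mod 4).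

open import Defs
open import Data.Nat using (ℕ; _<_; suc)
open import Data.Nat.Primality using (Prime)
open import Data.Integer using (ℤ; +_; _+_; _-_; _*_; _^_; 0ℤ; 1ℤ)
open import Data.Integer.Divisibility using (_∣_)
open import Data.Product using (_×_)
open import Data.Sum using (_⊎_)
open import Relation.Binary.PropositionalEquality using (_≡_)
open import Relation.Nullary using (¬_)
import Data.Nat as ℕ
import Data.Nat.Divisibility as ℕ
import Data.Integer as ℤ

open import Data.Empty using (⊥-elim)
open import Data.List using (_∷_; [])
open import Data.Nat using (zero)
open import Data.Nat.Properties using (m<n⇒n≢0)
open import Data.Product using (∃-syntax; _,_)
open import Data.Sum using (inj₁; inj₂)
open import Data.Integer.DivMod using (a≡a%ℕn+[a/ℕn]*n; n%ℕd<d)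
open import Data.Integer.Properties using (*-comm; *-assoc; +-comm; +-identityˡ; *-cancelˡ-≡; *-cancelʳ-≡; i*j≢0; pos-*)
open import Data.Integer.Divisibility.Signed as Signed
  using (divides; ∣-refl; ∣m∣n⇒∣m+n; ∣m∣n⇒∣m-n; ∣n⇒∣m*n; ∣m⇒∣m*n; ∣ᵤ⇒∣; ∣⇒∣ᵤ)
open import Data.Integer.Tactic.RingSolver using (solve; solve-∀)
open import Relation.Binary.PropositionalEquality using (_≢_; refl; sym; trans; cong; cong₂; subst; module ≡-Reasoning)
open import Relation.Nullary using (contradiction)

open ≡-Reasoning

IsOdd : ℤ → Set
IsOdd x = ∃[ k ] x ≡ + 2 * k + 1ℤ

data Parity (x : ℤ) : Set where
  even : ∀ k → x ≡ + 2 * k → Parity x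
  odd  : ∀ k → x ≡ + 2 * k + 1ℤ → Parity x

parity : ∀ x → Parity x
parity x with x ℤ.%ℕ 2 | n%ℕd<d x 2 | a≡a%ℕn+[a/ℕn]*n x 2
... | 0           | _                 | x≡ = even (x ℤ./ℕ 2) (begin
  x                        ≡⟨ x≡ ⟩
  + 0 + x ℤ./ℕ 2 * + 2     ≡⟨ +-identityˡ (x ℤ./ℕ 2 * + 2) ⟩
  x ℤ./ℕ 2 * + 2           ≡⟨ *-comm (x ℤ./ℕ 2) (+ 2) ⟩
  + 2 * (x ℤ./ℕ 2)         ∎)
... | 1           | _                 | x≡ = odd (x ℤ./ℕ 2) (begin
  x                        ≡⟨ x≡ ⟩
  + 1 + x ℤ./ℕ 2 * + 2     ≡⟨ +-comm (+ 1) (x ℤ./ℕ 2 * + 2) ⟩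
  x ℤ./ℕ 2 * + 2 + + 1     ≡⟨ cong (_+ 1ℤ) (*-comm (x ℤ./ℕ 2) (+ 2)) ⟩
  + 2 * (x ℤ./ℕ 2) + 1ℤ    ∎)
... | suc (suc _) | ℕ.s≤s (ℕ.s≤s ()) | _

2k≢2j+1 : ∀ k j → + 2 * k ≢ + 2 * j + 1ℤ
2k≢2j+1 k j 2k≡2j+1 = contradiction (ℕ.∣1⇒≡1 (∣⇒∣ᵤ (divides (k - j) 1≡[k-j]*2))) (λ ())
  where
  1≡[k-j]*2 : 1ℤ ≡ (k - j) * + 2
  1≡[k-j]*2 = begin
    1ℤ                         ≡⟨ solve (j ∷ []) ⟩
    + 2 * j + 1ℤ - + 2 * j     ≡⟨ cong (_- + 2 * j) (sym 2k≡2j+1) ⟩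
    + 2 * k - + 2 * j          ≡⟨ solve (k ∷ j ∷ []) ⟩
    (k - j) * + 2              ∎

IsOdd⇒¬2∣ : ∀ {x} → IsOdd x → ¬ (+ 2 Signed.∣ x)
IsOdd⇒¬2∣ (k , refl) (divides q 2k+1≡q*2) = 2k≢2j+1 q k (trans (*-comm (+ 2) q) (sym 2k+1≡q*2))

Odd⇒IsOdd : ∀ {x} → Odd x → IsOdd x
Odd⇒IsOdd {x} x-odd with parity x
... | odd k x≡  = k , x≡
... | even k x≡ = ⊥-elim (x-odd (∣⇒∣ᵤ (divides k (trans x≡ (*-comm (+ 2) k)))))

IsOdd⇒NonZero : ∀ {x} → IsOdd x → ℤ.NonZero x
IsOdd⇒NonZero (k , refl) = ℤ.≢-nonZero (λ 2k+1≡0 → 2k≢2j+1 0ℤ k (sym 2k+1≡0))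

IsOdd-* : ∀ {x y} → IsOdd x → IsOdd y → IsOdd (x * y)
IsOdd-* (i , refl) (j , refl) = + 2 * i * j + i + j , solve (i ∷ j ∷ [])

IsOdd-*⁻¹ˡ : ∀ x {y} → IsOdd (x * y) → IsOdd x
IsOdd-*⁻¹ˡ x {y} xy-odd with parity x
... | odd k x≡  = k , x≡
... | even k x≡ = ⊥-elim (IsOdd⇒¬2∣ xy-odd (divides (k * y) (begin
  x * y          ≡⟨ cong (_* y) x≡ ⟩
  + 2 * k * y    ≡⟨ solve (k ∷ y ∷ []) ⟩
  k * y * + 2    ∎)))

IsOdd-*⁻¹ʳ : ∀ x {y} → IsOdd (x * y) → IsOdd y
IsOdd-*⁻¹ʳ x {y} xy-odd = IsOdd-*⁻¹ˡ y (subst IsOdd (*-comm x y) xy-odd)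

IsOdd-2x-y : ∀ x {y} → IsOdd y → IsOdd (+ 2 * x - y)
IsOdd-2x-y x (k , refl) = x - k - 1ℤ , solve (x ∷ k ∷ [])

x+2y≡1⇒IsOdd : ∀ {x} y → x + + 2 * y ≡ 1ℤ → IsOdd x
x+2y≡1⇒IsOdd {x} y x+2y≡1 = ℤ.- y , (begin
  x                         ≡⟨ solve (x ∷ y ∷ []) ⟩
  (x + + 2 * y) - + 2 * y   ≡⟨ cong (_- + 2 * y) x+2y≡1 ⟩
  1ℤ - + 2 * y              ≡⟨ solve (y ∷ []) ⟩
  + 2 * ℤ.- y + 1ℤ          ∎)

2∣x-y : ∀ {x y} → IsOdd x → IsOdd y → + 2 Signed.∣ x - y
2∣x-y (i , refl) (j , refl) = divides (i - j) (solve (i ∷ j ∷ []))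

IsOdd⇒8∣x*x-1 : ∀ {x} → IsOdd x → + 8 Signed.∣ x * x - 1ℤ
IsOdd⇒8∣x*x-1 (k , refl) = odd-square (parity k)
  where
  odd-square : ∀ {k} → Parity k → + 8 Signed.∣ (+ 2 * k + 1ℤ) * (+ 2 * k + 1ℤ) - 1ℤ
  odd-square (even j refl) = divides (+ 2 * j * j + j) (solve (j ∷ []))
  odd-square (odd  j refl) = divides (+ 2 * j * j + + 3 * j + 1ℤ) (solve (j ∷ []))

x*x≡m+4w⇒m≡1[4] : ∀ {x m} → IsOdd x → ∀ w → x * x ≡ m + + 4 * w → ∃[ f ] m ≡ + 4 * f + 1ℤ
x*x≡m+4w⇒m≡1[4] {x} {m} x-odd w xx≡ with IsOdd⇒8∣x*x-1 x-odd
... | divides e xx-1≡ = + 2 * e - w , (begin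
  m                                  ≡⟨ solve (m ∷ w ∷ []) ⟩
  m + + 4 * w - 1ℤ + 1ℤ - + 4 * w    ≡⟨ cong (λ z → z - 1ℤ + 1ℤ - + 4 * w) (sym xx≡) ⟩
  x * x - 1ℤ + 1ℤ - + 4 * w          ≡⟨ cong (λ z → z + 1ℤ - + 4 * w) xx-1≡ ⟩
  e * + 8 + 1ℤ - + 4 * w             ≡⟨ solve (e ∷ w ∷ []) ⟩
  + 4 * (+ 2 * e - w) + 1ℤ           ∎)

even-square⇒even : ∀ x {k} → x * x ≡ + 2 * k → ∃[ y ] x ≡ y * + 2
even-square⇒even x = from-parity (parity x)
  where
  from-parity : ∀ {x k} → Parity x → x * x ≡ + 2 * k → ∃[ y ] x ≡ y * + 2
  from-parity (even y x≡) _ = y , trans x≡ (*-comm (+ 2) y)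
  from-parity {k = k} (odd y refl) xx≡2k =
    ⊥-elim (2k≢2j+1 k (+ 2 * y * y + + 2 * y) (trans (sym xx≡2k) (solve (y ∷ []))))

x*x≡4m⇒x≡2y : ∀ x {m} → x * x ≡ + 4 * m → ∃[ y ] x ≡ y * + 2 × y * y ≡ m
x*x≡4m⇒x≡2y x {m} xx≡4m with even-square⇒even x {+ 2 * m} (trans xx≡4m (solve (m ∷ [])))
... | y , x≡2y = y , x≡2y , *-cancelˡ-≡ (+ 4) _ _ (begin
  + 4 * (y * y)              ≡⟨ solve (y ∷ []) ⟩
  (y * + 2) * (y * + 2)      ≡⟨ sym (cong₂ _*_ x≡2y x≡2y) ⟩
  x * x                      ≡⟨ xx≡4m ⟩
  + 4 * m                    ∎)

x*x≡8k⇒4∣x : ∀ x {k} → x * x ≡ + 8 * k → + 4 Signed.∣ x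
x*x≡8k⇒4∣x x {k} xx≡8k = from-half (x*x≡4m⇒x≡2y x {+ 2 * k} (trans xx≡8k (solve (k ∷ []))))
  where
  from-half : (∃[ y ] x ≡ y * + 2 × y * y ≡ + 2 * k) → + 4 Signed.∣ x
  from-half (y , x≡2y , yy≡2k) with even-square⇒even y yy≡2k
  ... | z , y≡2z = divides z (trans x≡2y (trans (cong (_* + 2) y≡2z) (*-assoc z (+ 2) (+ 2))))

*-pres-∣ : ∀ {i j m n} → i Signed.∣ m → j Signed.∣ n → i * j Signed.∣ m * n
*-pres-∣ {i} {j} (divides q refl) (divides r refl) = divides (q * r) (solve (i ∷ j ∷ q ∷ r ∷ []))

2^k≢0 : ∀ k → ℤ.NonZero ((+ 2) ^ k)
2^k≢0 zero    = _
2^k≢0 (suc k) = i*j≢0 (+ 2) ((+ 2) ^ k) {{_}} {{2^k≢0 k}}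

∥₂⇒oddPart : ∀ k {n} → k ∥₂ n → ∃[ d ] n ≡ d * (+ 2) ^ k × IsOdd d
∥₂⇒oddPart k {n} (2^k∣n , 2^[1+k]∤n) with ∣ᵤ⇒∣ {(+ 2) ^ k} {n} 2^k∣n
... | divides d n≡ with parity d
...   | odd j d≡  = d , n≡ , j , d≡
...   | even j d≡ = ⊥-elim (2^[1+k]∤n (∣⇒∣ᵤ (divides j (begin
  n                        ≡⟨ n≡ ⟩
  d * (+ 2) ^ k            ≡⟨ cong (_* (+ 2) ^ k) (trans d≡ (*-comm (+ 2) j)) ⟩
  j * + 2 * (+ 2) ^ k      ≡⟨ *-assoc j (+ 2) ((+ 2) ^ k) ⟩
  j * (+ 2) ^ suc k        ∎))))

oddPart⇒∥₂ : ∀ k {n d} → n ≡ d * (+ 2) ^ k → IsOdd d → k ∥₂ n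
oddPart⇒∥₂ k {d = d} refl d-odd = ∣⇒∣ᵤ (divides d refl) , 2^[1+k]∤n
  where
  2^[1+k]∤n : ¬ ((+ 2) ^ suc k ∣ d * (+ 2) ^ k)
  2^[1+k]∤n 2^[1+k]∣n with ∣ᵤ⇒∣ {(+ 2) ^ suc k} {d * (+ 2) ^ k} 2^[1+k]∣n
  ... | divides j n≡ = IsOdd⇒¬2∣ d-odd (divides j
    (*-cancelʳ-≡ d (j * + 2) ((+ 2) ^ k) {{2^k≢0 k}} (trans n≡ (sym (*-assoc j (+ 2) ((+ 2) ^ k))))))

Cong⇒≡ : ∀ {a b m} → Cong a b m → ∃[ q ] a ≡ q * m + b
Cong⇒≡ {a} {b} {m} a≡b with ∣ᵤ⇒∣ {m} {a - b} a≡b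
... | divides q a-b≡ = q , (begin
  a              ≡⟨ solve (a ∷ b ∷ []) ⟩
  (a - b) + b    ≡⟨ cong (_+ b) a-b≡ ⟩
  q * m + b      ∎)

norm/p≡1 : ∀ P N A B Cq uq v {n} .{{_ : ℤ.NonZero P}} → N ≡ + 2 * n →
  P ≡ (P * uq) * (P * uq) - (P * uq) * v * B + v * v * A * (N * P * Cq) →
  uq * (P * uq - v * B) + + 2 * (v * v * A * n * Cq) ≡ 1ℤ
norm/p≡1 P N A B Cq uq v {n} refl norm = *-cancelˡ-≡ P _ _ (begin
  P * (uq * (P * uq - v * B) + + 2 * (v * v * A * n * Cq))
    ≡⟨ solve (P ∷ A ∷ B ∷ Cq ∷ uq ∷ v ∷ n ∷ []) ⟩
  (P * uq) * (P * uq) - (P * uq) * v * B + v * v * A * (+ 2 * n * P * Cq)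
    ≡⟨ sym norm ⟩
  P
    ≡⟨ solve (P ∷ []) ⟩
  P * 1ℤ
    ∎)

4*norm≡X²-v²D : ∀ u v A B C →
  + 4 * (u * u - u * v * B + v * v * A * C)
    ≡ (+ 2 * u - v * B) * (+ 2 * u - v * B) - v * v * (B * B - + 4 * A * C)
4*norm≡X²-v²D = solve-∀

ApCq≡3[4] : ∀ A B Cq P N .{{_ : ℤ.NonZero N}} →
  Cong (B * B) ((B * B - + 4 * A * (N * P * Cq)) + + 12 * N) (+ 16 * N) →
  ∃[ k ] A * P * Cq ≡ + 4 * k + + 3
ApCq≡3[4] A B Cq P N B²≡ = from-quotient (Cong⇒≡ B²≡)
  where
  from-quotient : ∃[ q ] B * B ≡ q * (+ 16 * N) + ((B * B - + 4 * A * (N * P * Cq)) + + 12 * N) →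
    ∃[ k ] A * P * Cq ≡ + 4 * k + + 3
  from-quotient (q , B²≡′) = q , *-cancelˡ-≡ (+ 4 * N) _ _ {{i*j≢0 (+ 4) N}} (begin
    + 4 * N * (A * P * Cq)
      ≡⟨ solve (A ∷ B ∷ Cq ∷ P ∷ N ∷ []) ⟩
    B * B - (B * B - + 4 * A * (N * P * Cq))
      ≡⟨ cong (_- (B * B - + 4 * A * (N * P * Cq))) B²≡′ ⟩
    q * (+ 16 * N) + ((B * B - + 4 * A * (N * P * Cq)) + + 12 * N) - (B * B - + 4 * A * (N * P * Cq))
      ≡⟨ solve (A ∷ B ∷ Cq ∷ P ∷ N ∷ q ∷ []) ⟩
    + 4 * N * (+ 4 * q + + 3)
      ∎)

case-a⇒B-odd : ∀ {B D N n} → N ≡ + 2 * n →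
  Cong (B * B) (D + + 12 * N) (+ 16 * N) → Cong D 1ℤ (+ 8) → IsOdd B
case-a⇒B-odd {B} {D} {N} {n} N≡2n B²≡ D≡1 = from-quotients (Cong⇒≡ B²≡) (Cong⇒≡ D≡1)
  where
  from-quotients : ∃[ q ] B * B ≡ q * (+ 16 * N) + (D + + 12 * N) → ∃[ r ] D ≡ r * + 8 + 1ℤ → IsOdd B
  from-quotients (q , B²≡′) (r , D≡) = IsOdd-*⁻¹ˡ B (q * + 16 * n + + 4 * r + + 12 * n , (begin
    B * B                                                          ≡⟨ B²≡′ ⟩
    q * (+ 16 * N) + (D + + 12 * N)                                ≡⟨ cong₂ (λ D N → q * (+ 16 * N) + (D + + 12 * N)) D≡ N≡2n ⟩
    q * (+ 16 * (+ 2 * n)) + (r * + 8 + 1ℤ + + 12 * (+ 2 * n))     ≡⟨ solve (q ∷ r ∷ n ∷ []) ⟩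
    + 2 * (q * + 16 * n + + 4 * r + + 12 * n) + 1ℤ                 ∎))

case-b⇒4∣B : ∀ {B D N n} → N ≡ + 2 * n →
  Cong (B * B) (D + + 12 * N) (+ 16 * N) → 3 ∥₂ D → + 4 Signed.∣ B
case-b⇒4∣B {B} {D} {N} {n} N≡2n B²≡ D∥8 = from-quotient (Cong⇒≡ B²≡) (∥₂⇒oddPart 3 {D} D∥8)
  where
  from-quotient : ∃[ q ] B * B ≡ q * (+ 16 * N) + (D + + 12 * N) → ∃[ d ] D ≡ d * + 8 × IsOdd d →
    + 4 Signed.∣ B
  from-quotient (q , B²≡′) (d , D≡ , _) = x*x≡8k⇒4∣x B {q * + 4 * n + d + + 3 * n} (begin
    B * B                                                          ≡⟨ B²≡′ ⟩
    q * (+ 16 * N) + (D + + 12 * N)                                ≡⟨ cong₂ (λ D N → q * (+ 16 * N) + (D + + 12 * N)) D≡ N≡2n ⟩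
    q * (+ 16 * (+ 2 * n)) + (d * + 8 + + 12 * (+ 2 * n))          ≡⟨ solve (q ∷ d ∷ n ∷ []) ⟩
    + 8 * (q * + 4 * n + d + + 3 * n)                              ∎)

case-c⇒B≡2·odd×D≡4[16] : ∀ {B D N} →
  Cong (B * B) (D + + 12 * N) (+ 16 * N) → 2 ∥₂ D → + 4 ∣ N →
  (∃[ b ] B ≡ b * + 2 × IsOdd b) × (∃[ f ] D ≡ f * + 16 + + 4)
case-c⇒B≡2·odd×D≡4[16] {B} {D} {N} B²≡ D∥4 4∣N =
  from-quotients (Cong⇒≡ B²≡) (∥₂⇒oddPart 2 {D} D∥4) (∣ᵤ⇒∣ {+ 4} {N} 4∣N)
  where
  from-quotients : ∃[ q ] B * B ≡ q * (+ 16 * N) + (D + + 12 * N) → ∃[ d ] D ≡ d * + 4 × IsOdd d →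
    + 4 Signed.∣ N → (∃[ b ] B ≡ b * + 2 × IsOdd b) × (∃[ f ] D ≡ f * + 16 + + 4)
  from-quotients (q , B²≡′) (d , D≡ , (δ , d≡)) (divides n N≡) =
    from-half (x*x≡4m⇒x≡2y B {d + + 4 * (+ 4 * q * n + + 3 * n)} (begin
      B * B                                                   ≡⟨ B²≡′ ⟩
      q * (+ 16 * N) + (D + + 12 * N)                         ≡⟨ cong₂ (λ D N → q * (+ 16 * N) + (D + + 12 * N)) D≡ N≡ ⟩
      q * (+ 16 * (n * + 4)) + (d * + 4 + + 12 * (n * + 4))   ≡⟨ solve (q ∷ d ∷ n ∷ []) ⟩
      + 4 * (d + + 4 * (+ 4 * q * n + + 3 * n))               ∎))
    where
    from-half : ∃[ b ] B ≡ b * + 2 × b * b ≡ d + + 4 * (+ 4 * q * n + + 3 * n) →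
      (∃[ b ] B ≡ b * + 2 × IsOdd b) × (∃[ f ] D ≡ f * + 16 + + 4)
    from-half (b , B≡2b , b²≡) = (b , B≡2b , b-odd) , from-d≡1[4] (x*x≡m+4w⇒m≡1[4] b-odd (+ 4 * q * n + + 3 * n) b²≡)
      where
      b-odd : IsOdd b
      b-odd = IsOdd-*⁻¹ˡ b (δ + + 8 * q * n + + 6 * n , (begin
        b * b                                         ≡⟨ b²≡ ⟩
        d + + 4 * (+ 4 * q * n + + 3 * n)             ≡⟨ cong (_+ + 4 * (+ 4 * q * n + + 3 * n)) d≡ ⟩
        + 2 * δ + 1ℤ + + 4 * (+ 4 * q * n + + 3 * n)  ≡⟨ solve (δ ∷ q ∷ n ∷ []) ⟩
        + 2 * (δ + + 8 * q * n + + 6 * n) + 1ℤ        ∎))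
      from-d≡1[4] : ∃[ f ] d ≡ + 4 * f + 1ℤ → ∃[ f ] D ≡ f * + 16 + + 4
      from-d≡1[4] (f , d≡4f+1) = f , (begin
        D                      ≡⟨ D≡ ⟩
        d * + 4                ≡⟨ cong (_* + 4) d≡4f+1 ⟩
        (+ 4 * f + 1ℤ) * + 4   ≡⟨ solve (f ∷ []) ⟩
        f * + 16 + + 4         ∎)

case-a⇒2∣p : ∀ {P u v B D} → IsOdd v → IsOdd B → Cong D 1ℤ (+ 8) →
  + 4 * P ≡ (+ 2 * u - v * B) * (+ 2 * u - v * B) - v * v * D → + 2 Signed.∣ P
case-a⇒2∣p {u = u} {v} {B} {D} v-odd B-odd D≡1 4P≡ =
  Signed.*-cancelˡ-∣ (+ 4) (subst (+ 8 Signed.∣_) (sym 4P≡) 8∣X²-v²D)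
  where
  X²-v²D≡ : ∀ X V D → X * X - V * V * D ≡ (X * X - 1ℤ) - (V * V - 1ℤ) - V * V * (D - 1ℤ)
  X²-v²D≡ = solve-∀
  8∣X²-v²D : + 8 Signed.∣ (+ 2 * u - v * B) * (+ 2 * u - v * B) - v * v * D
  8∣X²-v²D = subst (+ 8 Signed.∣_) (sym (X²-v²D≡ (+ 2 * u - v * B) v D))
    (∣m∣n⇒∣m-n (∣m∣n⇒∣m-n (IsOdd⇒8∣x*x-1 (IsOdd-2x-y u (IsOdd-* v-odd B-odd))) (IsOdd⇒8∣x*x-1 v-odd))
               (∣n⇒∣m*n (v * v) (∣ᵤ⇒∣ {+ 8} {D - 1ℤ} D≡1)))

-- p = y² − 2v²d, where 2u − vB = 2y with y odd.
case-b⇒p≡3[4] : ∀ {P u v B D d} → IsOdd u → IsOdd v → + 4 Signed.∣ B → D ≡ d * + 8 → IsOdd d →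
  + 4 * P ≡ (+ 2 * u - v * B) * (+ 2 * u - v * B) - v * v * D → ∃[ l ] P ≡ + 4 * l + + 3
case-b⇒p≡3[4] (i , refl) (j , refl) (divides β refl) refl (δ , refl) 4P≡ =
  (i - (+ 2 * j + 1ℤ) * β) * (i - (+ 2 * j + 1ℤ) * β) + (i - (+ 2 * j + 1ℤ) * β)
    - + 2 * (j * j + j) * (+ 2 * δ + 1ℤ) - δ - 1ℤ
  , *-cancelˡ-≡ (+ 4) _ _ (trans 4P≡ (solve (i ∷ j ∷ β ∷ δ ∷ [])))

-- p = 4s² − v²d, where u − vb = 2s.
case-c⇒p≡3[4] : ∀ {P u v B D b f} → IsOdd u → IsOdd v → B ≡ b * + 2 → IsOdd b → D ≡ f * + 16 + + 4 →
  + 4 * P ≡ (+ 2 * u - v * B) * (+ 2 * u - v * B) - v * v * D → ∃[ l ] P ≡ + 4 * l + + 3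
case-c⇒p≡3[4] {f = f} (i , refl) (j , refl) refl (k , refl) refl 4P≡ =
  (i - + 2 * j * k - j - k) * (i - + 2 * j * k - j - k) - (j * j + j) * (+ 4 * f + 1ℤ) - f - 1ℤ
  , *-cancelˡ-≡ (+ 4) _ _ (trans 4P≡ (solve (i ∷ j ∷ k ∷ f ∷ [])))

v-odd⇒p≡3[4] : ∀ {P u v B D N n} → N ≡ + 2 * n → Cong (B * B) (D + + 12 * N) (+ 16 * N) →
  + 4 * P ≡ (+ 2 * u - v * B) * (+ 2 * u - v * B) - v * v * D →
  IsOdd P → IsOdd u → IsOdd v →
  Cong D 1ℤ (+ 8) ⊎ (3 ∥₂ D × 1 ∥₂ N) ⊎ (2 ∥₂ D × + 4 ∣ N) →
  ∃[ l ] P ≡ + 4 * l + + 3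
v-odd⇒p≡3[4] {P} {u} {v} {B} {D} {N} {n} N≡2n B²≡ 4P≡ P-odd u-odd v-odd (inj₁ D≡1) =
  ⊥-elim (IsOdd⇒¬2∣ P-odd
    (case-a⇒2∣p {u = u} {v} {B} {D} v-odd (case-a⇒B-odd {B} {D} {N} {n} N≡2n B²≡ D≡1) D≡1 4P≡))
v-odd⇒p≡3[4] {P} {u} {v} {B} {D} {N} {n} N≡2n B²≡ 4P≡ P-odd u-odd v-odd (inj₂ (inj₁ (D∥8 , _))) =
  let d , D≡8d , d-odd = ∥₂⇒oddPart 3 {D} D∥8
      4∣B = case-b⇒4∣B {B} {D} {N} {n} N≡2n B²≡ D∥8
  in case-b⇒p≡3[4] {P} {u} {v} {B} {D} {d} u-odd v-odd 4∣B D≡8d d-odd 4P≡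
v-odd⇒p≡3[4] {P} {u} {v} {B} {D} {N} {n} N≡2n B²≡ 4P≡ P-odd u-odd v-odd (inj₂ (inj₂ (D∥4 , 4∣N))) =
  let (b , B≡2b , b-odd) , (f , D≡) = case-c⇒B≡2·odd×D≡4[16] {B} {D} {N} B²≡ D∥4 4∣N
  in case-c⇒p≡3[4] {P} {u} {v} {B} {D} {b} {f} u-odd v-odd B≡2b b-odd D≡ 4P≡

-- Every term of Cq-A≡ is divisible by 4: ApCq·p ≡ 3·3 ≡ 1 (mod 4), and odd squares are 1 mod 8.
p≡3[4]⇒4∣Cq-A : ∀ {A Cq P k l} → IsOdd A → A * P * Cq ≡ + 4 * k + + 3 → P ≡ + 4 * l + + 3 →
  + 4 Signed.∣ Cq - A
p≡3[4]⇒4∣Cq-A {A} {Cq} {P} {k} {l} A-odd ApCq≡ P≡ =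
  subst (+ 4 Signed.∣_) (sym (Cq-A≡ A Cq P))
    (∣m∣n⇒∣m-n (∣m∣n⇒∣m-n (∣n⇒∣m*n A 4∣ApCq·p-1) (∣m⇒∣m*n Cq (4∣x*x-1 A-odd)))
               (∣n⇒∣m*n (A * A * Cq) (4∣x*x-1 P-odd)))
  where
  Cq-A≡ : ∀ A Cq P → Cq - A ≡ A * (A * P * Cq * P - 1ℤ) - (A * A - 1ℤ) * Cq - A * A * Cq * (P * P - 1ℤ)
  Cq-A≡ = solve-∀
  4∣x*x-1 : ∀ {x} → IsOdd x → + 4 Signed.∣ x * x - 1ℤ
  4∣x*x-1 x-odd = Signed.∣-trans (divides {+ 4} (+ 2) refl) (IsOdd⇒8∣x*x-1 x-odd)
  P-odd : IsOdd P
  P-odd = + 2 * l + 1ℤ , (begin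
    P                          ≡⟨ P≡ ⟩
    + 4 * l + + 3              ≡⟨ solve (l ∷ []) ⟩
    + 2 * (+ 2 * l + 1ℤ) + 1ℤ  ∎)
  4∣ApCq·p-1 : + 4 Signed.∣ A * P * Cq * P - 1ℤ
  4∣ApCq·p-1 = divides (+ 4 * k * l + + 3 * k + + 3 * l + + 2) (begin
    A * P * Cq * P - 1ℤ                     ≡⟨ cong₂ (λ E Q → E * Q - 1ℤ) ApCq≡ P≡ ⟩
    (+ 4 * k + + 3) * (+ 4 * l + + 3) - 1ℤ  ≡⟨ solve (k ∷ l ∷ []) ⟩
    (+ 4 * k * l + + 3 * k + + 3 * l + + 2) * + 4 ∎)

4∣v[Cq-A] : ∀ {A Cq P v k} → IsOdd A → IsOdd Cq → A * P * Cq ≡ + 4 * k + + 3 →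
  (IsOdd v → ∃[ l ] P ≡ + 4 * l + + 3) → + 4 Signed.∣ v * (Cq - A)
4∣v[Cq-A] {A} {Cq} {P} {v} {k} A-odd Cq-odd ApCq≡ p≡3[4] with parity v
... | even w v≡ = *-pres-∣ (divides w (trans v≡ (*-comm (+ 2) w))) (2∣x-y Cq-odd A-odd)
... | odd w v≡ with p≡3[4] (w , v≡)
...   | l , P≡ = ∣n⇒∣m*n v (p≡3[4]⇒4∣Cq-A {A} {Cq} {P} {k} {l} A-odd ApCq≡ P≡)

twiceTheta≡ : ∀ N lam N₁ A B Cq u uq v v₁ A₁ → let u' = u - v * B in
  twiceTheta N lam N₁ A B Cq u uq v v₁ A₁
    ≡ + 2 * (+ N - 1ℤ) * u' * (v * (Cq - A))
      + (+ 3 * + lam - + 2 * (+ N - 1ℤ) * v * A * uq) * (u' * u' - 1ℤ)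
      + + 6 * v₁ * A₁ * ((N₁ - 1ℤ) * (u' - 1ℤ))
twiceTheta≡ N lam N₁ A B Cq u uq v v₁ A₁ = regroup (+ N) (+ lam) N₁ A Cq uq v v₁ A₁ (u - v * B)
  where
  regroup : ∀ N lam N₁ A Cq uq v v₁ A₁ u' →
    + 2 * ((N - 1ℤ) * v * (u' * Cq + A * (uq * (1ℤ - u' * u') - u'))
           + + 3 * v₁ * A₁ * (N₁ - 1ℤ) * (u' - 1ℤ))
      + + 3 * lam * (u' * u' - 1ℤ)
    ≡ + 2 * (N - 1ℤ) * u' * (v * (Cq - A))
      + (+ 3 * lam - + 2 * (N - 1ℤ) * v * A * uq) * (u' * u' - 1ℤ)
      + + 6 * v₁ * A₁ * ((N₁ - 1ℤ) * (u' - 1ℤ))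
  regroup = solve-∀

8∣twiceTheta : ∀ N lam N₁ A B Cq u uq v v₁ A₁ → IsOdd (u - v * B) → IsOdd N₁ →
  + 4 Signed.∣ v * (Cq - A) → + 8 Signed.∣ twiceTheta N lam N₁ A B Cq u uq v v₁ A₁
8∣twiceTheta N lam N₁ A B Cq u uq v v₁ A₁ u'-odd N₁-odd 4∣v[Cq-A] =
  subst (+ 8 Signed.∣_) (sym (twiceTheta≡ N lam N₁ A B Cq u uq v v₁ A₁))
    (∣m∣n⇒∣m+n (∣m∣n⇒∣m+n
      (*-pres-∣ (∣m⇒∣m*n (u - v * B) (∣m⇒∣m*n (+ N - 1ℤ) (∣-refl {+ 2}))) 4∣v[Cq-A])
      (∣n⇒∣m*n (+ 3 * + lam - + 2 * (+ N - 1ℤ) * v * A * uq) (IsOdd⇒8∣x*x-1 u'-odd)))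
      (*-pres-∣ (∣m⇒∣m*n A₁ (∣m⇒∣m*n v₁ (divides {+ 2} (+ 3) refl)))
                (*-pres-∣ (2∣x-y N₁-odd 1-odd) (2∣x-y u'-odd 1-odd))))
  where
  1-odd : IsOdd 1ℤ
  1-odd = 0ℤ , refl

mainTheorem10 :
  (N lam : ℕ) (N₁ : ℤ) (c : ℕ) (Δ D A B C u v : ℤ) (p : ℕ) (Cq uq v₁ A₁ : ℤ) →
  -- N > 1, N = 2^λ(N) N₁ with N₁ odd
  1 < N → + N ≡ (+ 2) ^ lam * N₁ → Odd N₁ →
  -- D = c² Δ < 0, Δ fundamental, c the conductor
  0 < c → Fundamental Δ → D ≡ + (c ℕ.* c) * Δ → D ℤ.< 0ℤ →
  -- [A,B,C] primitive positive definite of discriminant D, gcd(A,N) = 1, N ∣ C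
  B * B - + 4 * A * C ≡ D → Primitive3 A B C → 0ℤ ℤ.< A →
  Coprime A (+ N) → + N ∣ C →
  -- π = u + vAα has prime norm p, p ∤ 6cN, p splits in 𝒪, p ∣ C, p ∣ u
  + p ≡ u * u - u * v * B + v * v * A * C → Prime p →
  ¬ (p ℕ.∣ 6 ℕ.* c ℕ.* N) → SplitsInOrder D p →
  + p ∣ C → + p ∣ u →
  -- Cq = C/(Np), uq = u/p, v₁ and A₁ the odd parts of v and A
  C ≡ + N * + p * Cq → u ≡ + p * uq →
  IsOddPart v v₁ → IsOddPart A A₁ →
  -- N even and B² ≡ D + 12N (mod 16N)
  2 ℕ.∣ N → Cong (B * B) (D + + 12 * + N) (+ 16 * + N) →
  ((Cong D 1ℤ (+ 8)
     ⊎ (3 ∥₂ D × 1 ∥₂ (+ N))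
     ⊎ (2 ∥₂ D × + 4 ∣ + N))
    → + 8 ∣ twiceTheta N lam N₁ A B Cq u uq v v₁ A₁)
  × ((3 ∥₂ D × 1 ∥₂ (+ N)) → + 4 ∣ B)
  × ((2 ∥₂ D × + 4 ∣ + N) → 1 ∥₂ B)
mainTheorem10 N lam N₁ c Δ D A B C u v p Cq uq v₁ A₁
  1<N _ N₁-odd _ _ _ _ refl _ _ _ _ norm _ _ _ _ _ refl refl _ _ (ℕ.divides n N≡n*2) B²≡
  with ApCq≡3[4] A B Cq (+ p) (+ N) {{ℕ.≢-nonZero (m<n⇒n≢0 1<N)}} B²≡
... | k , ApCq≡ =
    (λ case → ∣⇒∣ᵤ (8∣twiceTheta N lam N₁ A B Cq (+ p * uq) uq v v₁ A₁ u'-odd (Odd⇒IsOdd N₁-odd)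
      (4∣v[Cq-A] {A} {Cq} {+ p} {v} {k} A-odd Cq-odd ApCq≡ (p≡3[4] case))))
  , (λ { (D∥8 , _) → ∣⇒∣ᵤ (case-b⇒4∣B {B} {D} {+ N} {+ n} N≡2n B²≡ D∥8) })
  , (λ { (D∥4 , 4∣N) → let (b , B≡2b , b-odd) , _ = case-c⇒B≡2·odd×D≡4[16] {B} {D} {+ N} B²≡ D∥4 4∣N
                       in oddPart⇒∥₂ 1 B≡2b b-odd })
  where
  N≡2n : + N ≡ + 2 * + n
  N≡2n = trans (cong +_ N≡n*2) (trans (pos-* n 2) (*-comm (+ n) (+ 2)))
  ApCq-odd : IsOdd (A * + p * Cq)
  ApCq-odd = + 2 * k + 1ℤ , (begin
    A * + p * Cq                ≡⟨ ApCq≡ ⟩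
    + 4 * k + + 3               ≡⟨ solve (k ∷ []) ⟩
    + 2 * (+ 2 * k + 1ℤ) + 1ℤ   ∎)
  A-odd : IsOdd A
  A-odd = IsOdd-*⁻¹ˡ A (IsOdd-*⁻¹ˡ (A * + p) ApCq-odd)
  p-odd : IsOdd (+ p)
  p-odd = IsOdd-*⁻¹ʳ A (IsOdd-*⁻¹ˡ (A * + p) ApCq-odd)
  Cq-odd : IsOdd Cq
  Cq-odd = IsOdd-*⁻¹ʳ (A * + p) ApCq-odd
  uq·u'-odd : IsOdd (uq * (+ p * uq - v * B))
  uq·u'-odd = x+2y≡1⇒IsOdd _ (norm/p≡1 (+ p) (+ N) A B Cq uq v {+ n} {{IsOdd⇒NonZero p-odd}} N≡2n norm)
  u'-odd : IsOdd (+ p * uq - v * B)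
  u'-odd = IsOdd-*⁻¹ʳ uq uq·u'-odd
  u-odd : IsOdd (+ p * uq)
  u-odd = IsOdd-* p-odd (IsOdd-*⁻¹ˡ uq uq·u'-odd)
  4p≡ : + 4 * + p ≡ (+ 2 * (+ p * uq) - v * B) * (+ 2 * (+ p * uq) - v * B)
                      - v * v * (B * B - + 4 * A * (+ N * + p * Cq))
  4p≡ = trans (cong (+ 4 *_) norm) (4*norm≡X²-v²D (+ p * uq) v A B (+ N * + p * Cq))
  p≡3[4] : Cong D 1ℤ (+ 8) ⊎ (3 ∥₂ D × 1 ∥₂ (+ N)) ⊎ (2 ∥₂ D × + 4 ∣ + N) →
    IsOdd v → ∃[ l ] + p ≡ + 4 * l + + 3
  p≡3[4] case v-odd =
    v-odd⇒p≡3[4] {+ p} {+ p * uq} {v} {B} {D} {+ N} {+ n} N≡2n B²≡ 4p≡ p-odd u-odd v-odd case
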